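{- Let $P$ be a poset on a nonempty finite set $K$ with $|K|=k$, let $d'(P)=\max\{d(P|_A)\mid A\subsetneq K\}$ and $\varepsilon(P)=d'(P)/d(P)$. Then $d'(P)\le 2^{k-1}$, $\varepsilon(P)<1$, and for every positive integer $m$ $$0\le r(m,P):=d(P)^m-e(m,P)\le 2^{m(P)-1}d'(P)^m\le 2^{(k-1)(m+1)},$$ so that $e(m,P)=d(P)^m\bigl(1-O(\varepsilon(P)^m)\bigr)$ as $m\to\infty$; in particular $e(m,P)$ is asymptotically equal to $d(P)^m$.
   Context: $d(\cdot)$ is the number of downsets of a finite poset, $P|_A$ the induced subposet on $A$, $m(P)$ the number of minimal elements of $P$. For a finite poset $P$ on $K$ and a finite set $M$ disjoint from $K$ with $|M|=m$, $e(m,P)$ is the number of partial orders on $M\cup K$ inducing $P$ on $K$ whose set of minimal elements is exactly $M$. -}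

module Defs where

open import Data.Bool using (Bool; true; false)
open import Data.Bool.Properties using () renaming (_≟_ to _≟ᵇ_)
open import Data.Nat using (ℕ; zero; suc; _⊔_)
import Agda.Primitive
open import Data.Fin using (Fin; zero; suc; _↑ˡ_; _↑ʳ_)
open import Data.Fin.Properties using (all?; any?) renaming (_≟_ to _≟ᶠ_)
open import Data.List using (List; []; _∷_; concatMap; map; filter; length; foldr)
open import Data.Product using (_×_; _,_; ∃)
open import Relation.Nullary using (Dec; ¬_; ¬?; _×-dec_; _→-dec_)
open import Relation.Unary using (Pred; Decidable)
open import Relation.Binary.PropositionalEquality using (_≡_)

allFuns : ∀ {A : Set} (n : ℕ) → List A → List (Fin n → A)
allFuns zero    xs = (λ ()) ∷ []
allFuns {A} (suc n) xs =
  concatMap (λ a → map (λ f → cons a f) (allFuns n xs)) xs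
  where
  cons : A → (Fin n → A) → Fin (suc n) → A
  cons a f zero    = a
  cons a f (suc i) = f i

bools : List Bool
bools = true ∷ false ∷ []

-- subsets of Fin n, as characteristic functions (every subset occurs once)
Subset : ℕ → Set
Subset n = Fin n → Bool

allSubsets : (n : ℕ) → List (Subset n)
allSubsets n = allFuns n bools

-- binary relations on Fin n, as Bool-valued functions (each occurs once)
Rel : ℕ → Set
Rel n = Fin n → Fin n → Bool

allRels : (n : ℕ) → List (Rel n)
allRels n = allFuns n (allFuns n bools)

count : ∀ {A : Set} {P : Pred A Agda.Primitive.lzero} → Decidable P → List A → ℕ
count P? xs = length (filter P? xs)

maximum : List ℕ → ℕ
maximum = foldr _⊔_ 0

-- Partial orders on Fin n  (R x y ≡ true  means  x ≤ y)

IsPartialOrder : ∀ {n} → Rel n → Set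
IsPartialOrder {n} R =
  (∀ x → R x x ≡ true) ×
  (∀ x y → R x y ≡ true → R y x ≡ true → x ≡ y) ×
  (∀ x y z → R x y ≡ true → R y z ≡ true → R x z ≡ true)

isPartialOrder? : ∀ {n} → Decidable (IsPartialOrder {n})
isPartialOrder? R =
  all? (λ x → R x x ≟ᵇ true) ×-dec
  all? (λ x → all? (λ y → (R x y ≟ᵇ true) →-dec (R y x ≟ᵇ true) →-dec (x ≟ᶠ y))) ×-dec
  all? (λ x → all? (λ y → all? (λ z →
    (R x y ≟ᵇ true) →-dec (R y z ≟ᵇ true) →-dec (R x z ≟ᵇ true))))

record Poset (k : ℕ) : Set where
  field
    _≤P_  : Rel k
    isPO : IsPartialOrder _≤P_
open Poset public

-- D is a downset of the induced subposet R|_A  (D ⊆ A, closed downwards in A)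
IsDownsetOf : ∀ {n} → Rel n → Subset n → Subset n → Set
IsDownsetOf {n} R A D =
  (∀ x → D x ≡ true → A x ≡ true) ×
  (∀ x y → A x ≡ true → A y ≡ true → R y x ≡ true → D x ≡ true → D y ≡ true)

isDownsetOf? : ∀ {n} (R : Rel n) (A : Subset n) → Decidable (IsDownsetOf R A)
isDownsetOf? R A D =
  all? (λ x → (D x ≟ᵇ true) →-dec (A x ≟ᵇ true)) ×-dec
  all? (λ x → all? (λ y → (A x ≟ᵇ true) →-dec (A y ≟ᵇ true) →-dec
    (R y x ≟ᵇ true) →-dec (D x ≟ᵇ true) →-dec (D y ≟ᵇ true)))

dRestr : ∀ {k} → Poset k → Subset k → ℕ
dRestr P A = count (isDownsetOf? (_≤P_ P) A) (allSubsets _)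

d : ∀ {k} → Poset k → ℕ
d P = dRestr P (λ _ → true)

IsProper : ∀ {k} → Subset k → Set
IsProper {k} A = ∃ λ (x : Fin k) → A x ≡ false

isProper? : ∀ {k} → Decidable (IsProper {k})
isProper? A = any? (λ x → A x ≟ᵇ false)

d′ : ∀ {k} → Poset k → ℕ
d′ P = maximum (map (dRestr P) (filter isProper? (allSubsets _)))

IsMinimal : ∀ {n} → Rel n → Fin n → Set
IsMinimal {n} R x = ∀ y → R y x ≡ true → y ≡ x

isMinimal? : ∀ {n} (R : Rel n) → Decidable (IsMinimal R)
isMinimal? R x = all? (λ y → (R y x ≟ᵇ true) →-dec (y ≟ᶠ x))

minCount : ∀ {k} → Poset k → ℕ
minCount {k} P = count (isMinimal? (_≤P_ P)) (Data.List.allFin k)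
  where import Data.List

-- e(m,P)
-- M ∪ K is modelled as Fin (m + k): M = { i ↑ˡ k | i : Fin m },
-- K = { m ↑ʳ j | j : Fin k }.  Q is counted iff Q is a partial order,
-- Q induces P on K, and the set of minimal elements of Q is exactly M
-- (every element of M is minimal, no element of K is minimal).

IsExtension : ∀ m {k} → Poset k → Rel (m Data.Nat.+ k) → Set
IsExtension m {k} P Q =
  IsPartialOrder Q ×
  (∀ i j → Q (m ↑ʳ i) (m ↑ʳ j) ≡ _≤P_ P i j) ×
  (∀ (i : Fin m) → IsMinimal Q (i ↑ˡ k)) ×
  (∀ (j : Fin k) → ¬ IsMinimal Q (m ↑ʳ j))

isExtension? : ∀ m {k} (P : Poset k) → Decidable (IsExtension m P)
isExtension? m {k} P Q =
  isPartialOrder? Q ×-dec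
  all? (λ i → all? (λ j → Q (m ↑ʳ i) (m ↑ʳ j) ≟ᵇ _≤P_ P i j)) ×-dec
  all? (λ i → isMinimal? Q (i ↑ˡ k)) ×-dec
  all? (λ j → ¬? (isMinimal? Q (m ↑ʳ j)))

e : ℕ → ∀ {k} → Poset k → ℕ
e m {k} P = count (isExtension? m P) (allRels (m Data.Nat.+ k))

module Submission where

-- Downward closure embeds the downsets of a proper subposet P|_A into those of P, missing the
-- principal downset of a point outside A; hence d'(P) < d(P). Downsets of P|_A are subsets of A,
-- hence d'(P) ≤ 2^(k-1).
--
-- An extension Q with minimal set M is determined by the rows T i = K ∖ ↑i (i ∈ M), which are
-- downsets of P, and an m-tuple of downsets of P arises in this way iff every minimal element of P
-- lies outside some row. So e(m,P) ≤ d(P)^m, and the tuples violating the condition have all rows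
-- containing one minimal element p; as the downsets of P containing p embed into those of P|_(K ∖ p),
-- there are at most m(P) d'(P)^m of them. Finally m(P) ≤ 2^(m(P)-1).
--
-- All comparisons of counts are injections between duplicate-free enumerations of finite setoids
-- (subsets and relations up to pointwise equality), i.e. instances of the pigeonhole principle.

open import Defs
open import Level using (0ℓ)
open import Function using (_∘_; id)
open import Function.Bundles using (mk⇔)
open import Data.Bool using (Bool; true; false; not)
open import Data.Bool.Properties using (⇔→≡; ¬-not; not-involutive) renaming (_≟_ to _≟ᵇ_)
open import Data.Nat using (ℕ; zero; suc; _+_; _*_; _∸_; _^_; _≤_; _<_; _⊔_; z≤n; s≤s)
open import Data.Nat.Properties
open import Data.Fin using (Fin; zero; suc; punchIn; _↑ˡ_; _↑ʳ_; splitAt; join)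
open import Data.Fin.Properties
  using (all?; any?; ¬∀⟶∃¬; punchIn-punchOut; ↑ˡ-injective; ↑ʳ-injective; splitAt-↑ˡ; splitAt-↑ʳ; splitAt-join; join-splitAt)
  renaming (_≟_ to _≟ᶠ_)
open import Data.Product using (_×_; _,_; ∃; proj₁; proj₂)
open import Data.Sum using (_⊎_; inj₁; inj₂)
open import Data.List using (List; []; _∷_; _++_; map; filter; length; concatMap; allFin)
open import Data.List.Properties
  using (foldr-preservesᵇ; foldr-preservesᵒ; filter-≐; filter-++; filter-all; filter-none;
         length-filter; length-tabulate; length-++; length-map; length-removeAt′)
open import Data.List.Relation.Unary.All as All using (All; []; _∷_)
import Data.List.Relation.Unary.All.Properties as All
open import Data.List.Relation.Unary.Any as Any using (Any; here; there; index; _─_)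
import Data.List.Relation.Unary.Any.Properties as Any
open import Data.List.Relation.Unary.AllPairs using ([]; _∷_)
open import Data.List.Relation.Unary.Unique.Setoid using (Unique)
import Data.List.Relation.Unary.Unique.Setoid.Properties as Unique
import Data.List.Relation.Binary.Disjoint.Setoid as Disjoint
import Data.List.Membership.Setoid as Membership
import Data.List.Membership.Setoid.Properties as ∈
import Data.List.Membership.Propositional.Properties as ∈≡
import Data.Vec.Functional as Vector
import Data.Vec.Functional.Relation.Unary.All as VecAll
import Data.Vec.Functional.Relation.Binary.Pointwise.Properties as Pointwise
open import Relation.Nullary using (Dec; does; ¬_; yes; no; contradiction; _×-dec_; _→-dec_)
open import Relation.Nullary.Decidable using (dec-true)
open import Relation.Unary using (Pred; Decidable; _⊆_; _≐_; _∪_; _∩_; ∁; U)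
open import Relation.Unary.Properties using (_∪?_; _∩?_; ∁?; U?)
open import Relation.Binary using (Setoid; _Respects_)
open import Relation.Binary.PropositionalEquality

private
  variable
    A B I : Set

module _ {P : Pred A 0ℓ} {Q : Pred A 0ℓ} (P? : Decidable P) (Q? : Decidable Q) where

  count-mono : P ⊆ Q → ∀ xs → count P? xs ≤ count Q? xs
  count-mono P⊆Q [] = z≤n
  count-mono P⊆Q (x ∷ xs) with P? x | Q? x
  ... | yes _  | yes _ = s≤s (count-mono P⊆Q xs)
  ... | yes Px | no ¬Qx = contradiction (P⊆Q Px) ¬Qx
  ... | no _   | yes _ = m≤n⇒m≤1+n (count-mono P⊆Q xs)
  ... | no _   | no _  = count-mono P⊆Q xs

  count-≐ : P ≐ Q → ∀ xs → count P? xs ≡ count Q? xs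
  count-≐ P≐Q xs = cong length (filter-≐ P? Q? P≐Q xs)

  count-∪ : ∀ xs → count (P? ∪? Q?) xs ≤ count P? xs + count Q? xs
  count-∪ [] = z≤n
  count-∪ (x ∷ xs) with P? x | Q? x
  ... | yes _ | yes _ = s≤s (≤-trans (count-∪ xs) (+-monoʳ-≤ (count P? xs) (n≤1+n _)))
  ... | yes _ | no _  = s≤s (count-∪ xs)
  ... | no _  | yes _ = ≤-trans (s≤s (count-∪ xs)) (≤-reflexive (sym (+-suc _ _)))
  ... | no _  | no _  = count-∪ xs

module _ {P : Pred A 0ℓ} (P? : Decidable P) where

  count-universal : (∀ x → P x) → ∀ xs → count P? xs ≡ length xs
  count-universal all-P xs = cong length (filter-all P? (All.universal all-P xs))

  count-empty : (∀ x → ¬ P x) → ∀ xs → count P? xs ≡ 0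
  count-empty none-P xs = cong length (filter-none P? (All.universal none-P xs))

  count-++ : ∀ xs ys → count P? (xs ++ ys) ≡ count P? xs + count P? ys
  count-++ xs ys = trans (cong length (filter-++ P? xs ys)) (length-++ (filter P? xs))

  count-map : (f : B → A) → ∀ xs → count P? (map f xs) ≡ count (P? ∘ f) xs
  count-map f [] = refl
  count-map f (x ∷ xs) with P? (f x)
  ... | yes _ = cong suc (count-map f xs)
  ... | no _  = count-map f xs

count-union-bound : {P : Pred A 0ℓ} (P? : Decidable P) {R : I → Pred A 0ℓ} (R? : ∀ i → Decidable (R i))
  (is : List I) → (∀ {x} → P x → Any (λ i → R i x) is) →
  ∀ {b} xs → (∀ i → count (R? i) xs ≤ b) → count P? xs ≤ length is * b
count-union-bound P? R? [] covered xs _ = ≤-reflexive (count-empty P? (λ _ → Any.¬Any[] ∘ covered) xs)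
count-union-bound {P = P} P? {R} R? (i ∷ is) covered {b} xs bound = begin
  count P? xs                                      ≤⟨ count-mono P? (R? i ∪? (P? ∩? ∁? (R? i))) split xs ⟩
  count (R? i ∪? (P? ∩? ∁? (R? i))) xs             ≤⟨ count-∪ (R? i) (P? ∩? ∁? (R? i)) xs ⟩
  count (R? i) xs + count (P? ∩? ∁? (R? i)) xs     ≤⟨ +-mono-≤ (bound i) rest ⟩
  b + length is * b                                ∎
  where
  open ≤-Reasoning
  split : P ⊆ R i ∪ (P ∩ ∁ (R i))
  split {x} Px with R? i x
  ... | yes Rix = inj₁ Rix
  ... | no ¬Rix = inj₂ (Px , ¬Rix)
  covered′ : ∀ {x} → (P ∩ ∁ (R i)) x → Any (λ i → R i x) is
  covered′ (Px , ¬Rix) with covered Px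
  ... | here Rix = contradiction Rix ¬Rix
  ... | there any = any
  rest : count (P? ∩? ∁? (R? i)) xs ≤ length is * b
  rest = count-union-bound (P? ∩? ∁? (R? i)) R? is covered′ xs bound

module _ (S : Setoid 0ℓ 0ℓ) where
  open Setoid S using (_≈_) renaming (sym to ≈-sym; trans to ≈-trans)
  open Membership S using (_∈_)

  ∈-─⁺ : ∀ {x y ys} (x∈ys : x ∈ ys) → y ∈ ys → ¬ y ≈ x → y ∈ (ys ─ x∈ys)
  ∈-─⁺ (here x≈z)  (here y≈z)  y≉x = contradiction (≈-trans y≈z (≈-sym x≈z)) y≉x
  ∈-─⁺ (here _)    (there y∈ys) _  = y∈ys
  ∈-─⁺ (there _)   (here y≈z)  _   = here y≈z
  ∈-─⁺ (there x∈ys) (there y∈ys) y≉x = there (∈-─⁺ x∈ys y∈ys y≉x)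

  Unique-⊆⇒length-≤ : ∀ {xs ys} → Unique S xs → All (_∈ ys) xs → length xs ≤ length ys
  Unique-⊆⇒length-≤ [] [] = z≤n
  Unique-⊆⇒length-≤ {x ∷ xs} {ys} (x≉xs ∷ xs!) (x∈ys ∷ xs⊆ys) = begin
    suc (length xs)           ≤⟨ s≤s (Unique-⊆⇒length-≤ xs! xs⊆ys─x) ⟩
    suc (length (ys ─ x∈ys))  ≡⟨ sym (length-removeAt′ ys (index x∈ys)) ⟩
    length ys                 ∎
    where
    open ≤-Reasoning
    xs⊆ys─x = All.zipWith (λ (x≉y , y∈ys) → ∈-─⁺ x∈ys y∈ys (x≉y ∘ ≈-sym)) (x≉xs , xs⊆ys)

record InjectionOn (S T : Setoid 0ℓ 0ℓ)
  (P : Pred (Setoid.Carrier S) 0ℓ) (Q : Pred (Setoid.Carrier T) 0ℓ) : Set where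
  private
    module S = Setoid S
    module T = Setoid T
  field
    to        : S.Carrier → T.Carrier
    maps      : ∀ {x} → P x → Q (to x)
    injective : ∀ {x y} → P x → P y → to x T.≈ to y → x S.≈ y

module _ {S T : Setoid 0ℓ 0ℓ} where
  private
    module S = Setoid S
    module T = Setoid T
  open Membership T using (_∈_)

  module _ {P : Pred S.Carrier 0ℓ} {Q : Pred T.Carrier 0ℓ} (P? : Decidable P) (Q? : Decidable Q)
    (Q-resp : Q Respects T._≈_) (f : InjectionOn S T P Q) {xs ys}
    (xs! : Unique S xs) (ys-complete : ∀ y → y ∈ ys) where
    open InjectionOn f

    private
      image : List T.Carrier
      image = map to (filter P? xs)

      map⁺-on : ∀ {zs} → Unique S zs → All P zs → Unique T (map to zs)
      map⁺-on [] [] = []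
      map⁺-on (z≉zs ∷ zs!) (Pz ∷ Pzs) =
        All.map⁺ (All.zipWith (λ (z≉w , Pw) → z≉w ∘ injective Pz Pw) (z≉zs , Pzs)) ∷ map⁺-on zs! Pzs

      image! : Unique T image
      image! = map⁺-on (Unique.filter⁺ S P? xs!) (All.all-filter P? xs)

      image⊆ : All (_∈ filter Q? ys) image
      image⊆ = All.map⁺ (All.map (λ Px → ∈.∈-filter⁺ T Q? Q-resp (ys-complete _) (maps Px))
                                 (All.all-filter P? xs))

      length-image : length image ≡ count P? xs
      length-image = length-map to (filter P? xs)

    count-≤-injection : count P? xs ≤ count Q? ys
    count-≤-injection = ≤-trans (≤-reflexive (sym length-image)) (Unique-⊆⇒length-≤ T image! image⊆)

    count-<-injection : ∀ {y} → Q y → (∀ {x} → P x → ¬ to x T.≈ y) → count P? xs < count Q? ys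
    count-<-injection Qy y∉image = ≤-trans (s≤s (≤-reflexive (sym length-image)))
      (Unique-⊆⇒length-≤ T (All.map⁺ (All.map (λ Px → y∉image Px ∘ T.sym) (All.all-filter P? xs))
                              ∷ image!)
                           (∈.∈-filter⁺ T Q? Q-resp (ys-complete _) Qy ∷ image⊆))

record IsEnumeration (S : Setoid 0ℓ 0ℓ) (xs : List (Setoid.Carrier S)) : Set where
  field
    unique   : Unique S xs
    complete : ∀ x → Membership._∈_ S x xs

bools-isEnumeration : IsEnumeration (setoid Bool) bools
bools-isEnumeration = record
  { unique   = ((λ ()) ∷ []) ∷ [] ∷ []
  ; complete = λ { true → here refl ; false → there (here refl) }
  }

-- allFuns (suc n) xs is built from allFuns n xs by a where-bound prepending function,
-- which the lemmas below only know through its pointwise behaviour.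
module Prepend (S : Setoid 0ℓ 0ℓ) {n}
  (cons : Setoid.Carrier S → (Fin n → Setoid.Carrier S) → Fin (suc n) → Setoid.Carrier S)
  (cons≗∷ : ∀ a f → cons a f ≗ a Vector.∷ f) (fs : List (Fin n → Setoid.Carrier S)) where
  open Setoid S using (Carrier; _≈_; reflexive) renaming (sym to ≈-sym; trans to ≈-trans)
  open Membership S using (_∈_)
  private
    Sₙ  = Pointwise.setoid S n
    Sₙ₊₁ = Pointwise.setoid S (suc n)
    open Membership Sₙ using () renaming (_∈_ to _∈ₙ_)
    open Membership Sₙ₊₁ using () renaming (_∈_ to _∈ₙ₊₁_)
    open Setoid Sₙ using () renaming (_≈_ to _≋ₙ_)
    open Setoid Sₙ₊₁ using () renaming (_≈_ to _≋ₙ₊₁_)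

    cons≈∷ : ∀ a f i → cons a f i ≈ (a Vector.∷ f) i
    cons≈∷ a f i = reflexive (cons≗∷ a f i)

  prepend : List Carrier → List (Fin (suc n) → Carrier)
  prepend = concatMap (λ a → map (cons a) fs)

  module _ {P : Pred Carrier 0ℓ} (P? : Decidable P) where
    private
      head : ∀ {a f} → VecAll.All P (cons a f) → P a
      head {a} {f} all-P = subst P (cons≗∷ a f zero) (all-P zero)

      tail : ∀ {a f} → VecAll.All P (cons a f) → VecAll.All P f
      tail {a} {f} all-P i = subst P (cons≗∷ a f (suc i)) (all-P (suc i))

      cons⁺ : ∀ {a f} → P a → VecAll.All P f → VecAll.All P (cons a f)
      cons⁺ {a} {f} Pa all-P zero    = subst P (sym (cons≗∷ a f zero)) Pa
      cons⁺ {a} {f} Pa all-P (suc i) = subst P (sym (cons≗∷ a f (suc i))) (all-P i)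

    count-cons : ∀ a → count (VecAll.all P? ∘ cons a) fs ≡ count P? (a ∷ []) * count (VecAll.all P?) fs
    count-cons a with P? a
    ... | yes Pa = trans (count-≐ _ (VecAll.all P?) (tail , cons⁺ Pa) fs) (sym (+-identityʳ _))
    ... | no ¬Pa = count-empty (VecAll.all P? ∘ cons a) (λ _ → ¬Pa ∘ head) fs

    count-prepend : ∀ xs → count (VecAll.all P?) (prepend xs) ≡ count P? xs * count (VecAll.all P?) fs
    count-prepend [] = refl
    count-prepend (a ∷ xs) = begin
      count (VecAll.all P?) (map (cons a) fs ++ prepend xs)
        ≡⟨ count-++ (VecAll.all P?) (map (cons a) fs) (prepend xs) ⟩
      count (VecAll.all P?) (map (cons a) fs) + count (VecAll.all P?) (prepend xs)
        ≡⟨ cong₂ _+_ (trans (count-map (VecAll.all P?) (cons a) fs) (count-cons a)) (count-prepend xs) ⟩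
      count P? (a ∷ []) * N + count P? xs * N
        ≡⟨ sym (*-distribʳ-+ N (count P? (a ∷ [])) (count P? xs)) ⟩
      (count P? (a ∷ []) + count P? xs) * N
        ≡⟨ cong (_* N) (sym (count-++ P? (a ∷ []) xs)) ⟩
      count P? (a ∷ xs) * N ∎
      where
      open ≡-Reasoning
      N = count (VecAll.all P?) fs

  prepend-complete : ∀ {f} → Vector.tail f ∈ₙ fs → ∀ {xs} → Vector.head f ∈ xs → f ∈ₙ₊₁ prepend xs
  prepend-complete {f} tail∈fs {a ∷ xs} (here f₀≈a) = Any.++⁺ˡ (Any.map⁺ (Any.map f≈cons tail∈fs))
    where
    f≈cons : ∀ {g} → Vector.tail f ≋ₙ g → f ≋ₙ₊₁ cons a g
    f≈cons {g} tail≈g zero    = ≈-trans f₀≈a (≈-sym (cons≈∷ a g zero))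
    f≈cons {g} tail≈g (suc i) = ≈-trans (tail≈g i) (≈-sym (cons≈∷ a g (suc i)))
  prepend-complete tail∈fs {a ∷ xs} (there f₀∈xs) =
    Any.++⁺ʳ (map (cons a) fs) (prepend-complete tail∈fs f₀∈xs)

  private
    ∈-map-cons⁻ : ∀ {a v} → v ∈ₙ₊₁ map (cons a) fs → Vector.head v ≈ a
    ∈-map-cons⁻ {a} v∈ =
      let f , _ , v≈cons = ∈.∈-map⁻ Sₙ Sₙ₊₁ v∈ in ≈-trans (v≈cons zero) (cons≈∷ a f zero)

    ∈-prepend⁻ : ∀ {v xs} → v ∈ₙ₊₁ prepend xs → Vector.head v ∈ xs
    ∈-prepend⁻ {xs = a ∷ xs} v∈ with Any.++⁻ (map (cons a) fs) v∈
    ... | inj₁ v∈map  = here (∈-map-cons⁻ v∈map)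
    ... | inj₂ v∈rest = there (∈-prepend⁻ v∈rest)

  prepend-unique : Unique Sₙ fs → ∀ {xs} → Unique S xs → Unique Sₙ₊₁ (prepend xs)
  prepend-unique fs! [] = []
  prepend-unique fs! {a ∷ xs} (a∉xs ∷ xs!) =
    Unique.++⁺ Sₙ₊₁ (Unique.map⁺ Sₙ Sₙ₊₁ cons-injective fs!) (prepend-unique fs! xs!) disjoint
    where
    cons-injective : ∀ {f g} → cons a f ≋ₙ₊₁ cons a g → f ≋ₙ g
    cons-injective {f} {g} eq i =
      ≈-trans (≈-sym (cons≈∷ a f (suc i))) (≈-trans (eq (suc i)) (cons≈∷ a g (suc i)))
    disjoint : Disjoint.Disjoint Sₙ₊₁ (map (cons a) fs) (prepend xs)
    disjoint (v∈map , v∈rest) =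
      All.All¬⇒¬Any a∉xs (∈.∈-resp-≈ S (∈-map-cons⁻ v∈map) (∈-prepend⁻ v∈rest))

allFuns-isEnumeration : ∀ {S : Setoid 0ℓ 0ℓ} {xs} → IsEnumeration S xs →
  ∀ n → IsEnumeration (Pointwise.setoid S n) (allFuns n xs)
allFuns-isEnumeration enum zero = record { unique = [] ∷ [] ; complete = λ _ → here (λ ()) }
allFuns-isEnumeration {S} {xs} enum (suc n) = record
  { unique   = Prepend.prepend-unique S _ (λ _ _ → λ { zero → refl ; (suc _) → refl }) (allFuns n xs)
                 (unique (allFuns-isEnumeration enum n)) (unique enum)
  ; complete = λ f → Prepend.prepend-complete S _ (λ _ _ → λ { zero → refl ; (suc _) → refl }) (allFuns n xs)
                 (complete (allFuns-isEnumeration enum n) (Vector.tail f)) (complete enum (Vector.head f))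
  }
  where open IsEnumeration

count-allFuns : ∀ {P : Pred A 0ℓ} (P? : Decidable P) n xs →
  count (VecAll.all P?) (allFuns n xs) ≡ count P? xs ^ n
count-allFuns P? zero xs = refl
count-allFuns P? (suc n) xs =
  trans (Prepend.count-prepend (setoid _) _ (λ _ _ → λ { zero → refl ; (suc _) → refl }) (allFuns n xs) P? xs)
        (cong (count P? xs *_) (count-allFuns P? n xs))

length-allFuns : ∀ n (xs : List A) → length (allFuns n xs) ≡ length xs ^ n
length-allFuns n xs = begin
  length (allFuns n xs)                 ≡⟨ count-universal (VecAll.all U?) (λ _ _ → _) (allFuns n xs) ⟨
  count (VecAll.all U?) (allFuns n xs)  ≡⟨ count-allFuns U? n xs ⟩
  count U? xs ^ n                       ≡⟨ cong (_^ n) (count-universal U? (λ _ → _) xs) ⟩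
  length xs ^ n                         ∎
  where open ≡-Reasoning

Subsetₛ : ℕ → Setoid 0ℓ 0ℓ
Subsetₛ = Pointwise.setoid (setoid Bool)

allSubsets-isEnumeration : ∀ n → IsEnumeration (Subsetₛ n) (allSubsets n)
allSubsets-isEnumeration = allFuns-isEnumeration bools-isEnumeration

witness : ∀ {X : Set} (x? : Dec X) → does x? ≡ true → X
witness (yes x) _ = x
witness (no _) ()

not≡true⁺ : ∀ {b} → b ≢ true → not b ≡ true
not≡true⁺ {false} _ = refl
not≡true⁺ {true} b≢true = contradiction refl b≢true

not≡true⁻ : ∀ {b} → not b ≡ true → b ≢ true
not≡true⁻ {false} _ ()

full : ∀ {n} → Subset n
full _ = true

delete : ∀ {n} → Fin n → Subset n → Subset n
delete p D x with x ≟ᶠ p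
... | yes _ = false
... | no _  = D x

Contains : ∀ {n} → Fin n → Pred (Subset n) 0ℓ
Contains p D = D p ≡ true

module _ {n} (R : Rel n) where
  open Setoid (Subsetₛ n) using (_≈_)

  IsDownsetOf-respʳ : ∀ {A} → IsDownsetOf R A Respects _≈_
  IsDownsetOf-respʳ D≋D′ (D⊆A , D-closed) =
    (λ x D′x → D⊆A x (trans (D≋D′ x) D′x)) ,
    (λ x y Ax Ay y≤x D′x → trans (sym (D≋D′ y)) (D-closed x y Ax Ay y≤x (trans (D≋D′ x) D′x)))

  IsDownsetOf-respˡ : ∀ {A A′ D} → A ≈ A′ → IsDownsetOf R A D → IsDownsetOf R A′ D
  IsDownsetOf-respˡ A≋A′ (D⊆A , D-closed) =
    (λ x Dx → trans (sym (A≋A′ x)) (D⊆A x Dx)) ,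
    (λ x y A′x A′y → D-closed x y (trans (A≋A′ x) A′x) (trans (A≋A′ y) A′y))

count-downsets-≤-2^ : ∀ {n} (R : Rel (suc n)) A → IsProper A →
  count (isDownsetOf? R A) (allSubsets (suc n)) ≤ 2 ^ n
count-downsets-≤-2^ {n} R A (x , Ax≡false) = begin
  count (isDownsetOf? R A) (allSubsets (suc n))  ≤⟨ count-≤-injection (isDownsetOf? R A) U? (λ _ _ → _) restrict
                                                      (unique (allSubsets-isEnumeration (suc n)))
                                                      (complete (allSubsets-isEnumeration n)) ⟩
  count U? (allSubsets n)                       ≡⟨ count-universal U? (λ _ → _) (allSubsets n) ⟩
  length (allSubsets n)                         ≡⟨ length-allFuns n bools ⟩
  2 ^ n                                         ∎
  where
  open ≤-Reasoning
  open IsEnumeration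
  outside : ∀ {D} → IsDownsetOf R A D → D x ≡ false
  outside (D⊆A , _) = ¬-not (λ Dx → contradiction (trans (sym (D⊆A x Dx)) Ax≡false) λ ())
  restrict : InjectionOn (Subsetₛ (suc n)) (Subsetₛ n) (IsDownsetOf R A) U
  restrict = record
    { to        = λ D → D ∘ punchIn x
    ; maps      = λ _ → _
    ; injective = agree-everywhere
    }
    where
    agree-everywhere : ∀ {D D′} → IsDownsetOf R A D → IsDownsetOf R A D′ →
      (∀ z → D (punchIn x z) ≡ D′ (punchIn x z)) → ∀ y → D y ≡ D′ y
    agree-everywhere {D} {D′} dD dD′ D≋D′ y with x ≟ᶠ y
    ... | yes refl = trans (outside dD) (sym (outside dD′))
    ... | no x≢y   = subst (λ z → D z ≡ D′ z) (punchIn-punchOut x≢y) (D≋D′ _)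

module _ {k} (P : Poset k) where
  private
    R = _≤P_ P
    infix 4 _≋_
    _≋_ = Setoid._≈_ (Subsetₛ k)
    ≼-refl    = proj₁ (isPO P)
    ≼-antisym = proj₁ (proj₂ (isPO P))
    ≼-trans   = proj₂ (proj₂ (isPO P))
    properSubsets = filter isProper? (allSubsets k)

  dRestr-cong : ∀ {A A′} → A ≋ A′ → dRestr P A ≡ dRestr P A′
  dRestr-cong A≋A′ = count-≐ (isDownsetOf? R _) (isDownsetOf? R _)
    (IsDownsetOf-respˡ R A≋A′ , IsDownsetOf-respˡ R (sym ∘ A≋A′)) (allSubsets k)

  dRestr≤d′ : ∀ {A} → IsProper A → dRestr P A ≤ d′ P
  dRestr≤d′ {A} A-proper = foldr-preservesᵒ {P = dRestr P A ≤_} {f = _⊔_} pres 0 (map (dRestr P) properSubsets)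
    (inj₂ (Any.map⁺ (Any.map (≤-reflexive ∘ dRestr-cong) A∈properSubsets)))
    where
    pres : ∀ x y → dRestr P A ≤ x ⊎ dRestr P A ≤ y → dRestr P A ≤ x ⊔ y
    pres x y (inj₁ ≤x) = m≤n⇒m≤n⊔o y ≤x
    pres x y (inj₂ ≤y) = m≤n⇒m≤o⊔n x ≤y
    A∈properSubsets = ∈.∈-filter⁺ (Subsetₛ k) isProper? (λ A≋A′ (x , Ax) → x , trans (sym (A≋A′ x)) Ax)
                  (IsEnumeration.complete (allSubsets-isEnumeration k) A) A-proper

  d′-preserves : ∀ {Q : Pred ℕ 0ℓ} → (∀ {x y} → Q x → Q y → Q (x ⊔ y)) → Q 0 →
    (∀ {A} → IsProper A → Q (dRestr P A)) → Q (d′ P)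
  d′-preserves {Q} pres Q0 Q-proper = foldr-preservesᵇ {P = Q} {f = _⊔_} pres Q0
    (All.map⁺ (All.map Q-proper (All.all-filter isProper? (allSubsets k))))

  ↓_ : Subset k → Subset k
  (↓ D) y = does (any? λ z → (D z ≟ᵇ true) ×-dec (R y z ≟ᵇ true))

  ↓-elim : ∀ {D y} → (↓ D) y ≡ true → ∃ λ z → D z ≡ true × R y z ≡ true
  ↓-elim {D} {y} = witness (any? λ z → (D z ≟ᵇ true) ×-dec (R y z ≟ᵇ true))

  ↓-intro : ∀ {D y} z → D z ≡ true → R y z ≡ true → (↓ D) y ≡ true
  ↓-intro {D} {y} z Dz y≼z = dec-true (any? λ z → (D z ≟ᵇ true) ×-dec (R y z ≟ᵇ true)) (z , Dz , y≼z)

  ⊆↓ : ∀ {D y} → D y ≡ true → (↓ D) y ≡ true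
  ⊆↓ {y = y} Dy = ↓-intro y Dy (≼-refl y)

  ↓-isDownset : ∀ D → IsDownsetOf R full (↓ D)
  ↓-isDownset D = (λ _ _ → refl) , λ x y _ _ y≼x ↓Dx →
    let z , Dz , x≼z = ↓-elim ↓Dx in ↓-intro z Dz (≼-trans y x z y≼x x≼z)

  dRestr<d : ∀ {A} → IsProper A → dRestr P A < d P
  dRestr<d {A} (x , Ax≡false) = count-<-injection (isDownsetOf? R A) (isDownsetOf? R full) (IsDownsetOf-respʳ R)
    closure (unique (allSubsets-isEnumeration k)) (complete (allSubsets-isEnumeration k))
    principal-isDownset ↓D≉principal
    where
    open IsEnumeration
    ↓-reflects : ∀ {D D′ y} → IsDownsetOf R A D → IsDownsetOf R A D′ → ↓ D ≋ ↓ D′ →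
      D y ≡ true → D′ y ≡ true
    ↓-reflects {y = y} (D⊆A , _) (D′⊆A , D′-closed) ↓D≋↓D′ Dy =
      let z , D′z , y≼z = ↓-elim (trans (sym (↓D≋↓D′ y)) (⊆↓ Dy))
      in D′-closed z y (D′⊆A z D′z) (D⊆A y Dy) y≼z D′z
    closure : InjectionOn (Subsetₛ k) (Subsetₛ k) (IsDownsetOf R A) (IsDownsetOf R full)
    closure = record
      { to        = ↓_
      ; maps      = λ _ → ↓-isDownset _
      ; injective = λ dD dD′ ↓D≋↓D′ y →
          ⇔→≡ (mk⇔ (↓-reflects dD dD′ ↓D≋↓D′) (↓-reflects dD′ dD (sym ∘ ↓D≋↓D′)))
      }
    principal-isDownset : IsDownsetOf R full (λ y → R y x)
    principal-isDownset = (λ _ _ → refl) , λ z y _ _ y≼z z≼x → ≼-trans y z x y≼z z≼x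
    ↓D≉principal : ∀ {D} → IsDownsetOf R A D → ¬ ↓ D ≋ (λ y → R y x)
    ↓D≉principal {D} (D⊆A , _) ↓D≋principal =
      let z , Dz , x≼z = ↓-elim (trans (↓D≋principal x) (≼-refl x))
          z≡x = ≼-antisym z x (trans (sym (↓D≋principal z)) (⊆↓ Dz)) x≼z
      in contradiction (trans (sym (D⊆A z Dz)) (subst (λ w → A w ≡ false) (sym z≡x) Ax≡false)) λ ()

  count-downsets-∋≤d′ : ∀ p → count (isDownsetOf? R full ∩? (λ D → D p ≟ᵇ true)) (allSubsets k) ≤ d′ P
  count-downsets-∋≤d′ p = ≤-trans
    (count-≤-injection _ (isDownsetOf? R (delete p full)) (IsDownsetOf-respʳ R) deletion
      (unique (allSubsets-isEnumeration k)) (complete (allSubsets-isEnumeration k)))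
    (dRestr≤d′ (p , p∉K∖p))
    where
    open IsEnumeration
    p∉K∖p : delete p full p ≡ false
    p∉K∖p with p ≟ᶠ p
    ... | yes _  = refl
    ... | no p≢p = contradiction refl p≢p
    delete-⊆ : ∀ D x → delete p D x ≡ true → delete p full x ≡ true
    delete-⊆ D x with x ≟ᶠ p
    ... | yes _ = λ ()
    ... | no _  = λ _ → refl
    delete-closed : ∀ {D} → IsDownsetOf R full D → ∀ x y → delete p full x ≡ true → delete p full y ≡ true →
      R y x ≡ true → delete p D x ≡ true → delete p D y ≡ true
    delete-closed (_ , D-closed) x y with x ≟ᶠ p | y ≟ᶠ p
    ... | yes _ | _     = λ ()
    ... | no _  | yes _ = λ _ ()
    ... | no _  | no _  = λ _ _ → D-closed x y refl refl
    delete-injective : ∀ {D D′} → (IsDownsetOf R full ∩ Contains p) D → (IsDownsetOf R full ∩ Contains p) D′ →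
      delete p D ≋ delete p D′ → D ≋ D′
    delete-injective {D} {D′} (_ , Dp) (_ , D′p) eq x with x ≟ᶠ p | eq x
    ... | yes refl | _ = trans Dp (sym D′p)
    ... | no _ | Dx≡D′x = Dx≡D′x
    deletion : InjectionOn (Subsetₛ k) (Subsetₛ k)
      (IsDownsetOf R full ∩ Contains p) (IsDownsetOf R (delete p full))
    deletion = record
      { to        = delete p
      ; maps      = λ (dD , _) → delete-⊆ _ , delete-closed dD
      ; injective = delete-injective
      }

Relₛ : ℕ → Setoid 0ℓ 0ℓ
Relₛ n = Pointwise.setoid (Subsetₛ n) n

allRels-isEnumeration : ∀ n → IsEnumeration (Relₛ n) (allRels n)
allRels-isEnumeration n = allFuns-isEnumeration (allSubsets-isEnumeration n) n

module Extensions {k} (P : Poset k) (m : ℕ) where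
  private
    R = _≤P_ P
    ≼-refl    = proj₁ (isPO P)
    ≼-antisym = proj₁ (proj₂ (isPO P))
    ≼-trans   = proj₂ (proj₂ (isPO P))
    Tupleₛ = Pointwise.setoid (Subsetₛ k) m
    open Setoid Tupleₛ using () renaming (_≈_ to _≋_)
    open Setoid (Relₛ (m + k)) using () renaming (_≈_ to _≋ᴿ_)

    ↑ˡ≢↑ʳ : ∀ i j → i ↑ˡ k ≢ m ↑ʳ j
    ↑ˡ≢↑ʳ i j eq with trans (sym (splitAt-↑ˡ m i k)) (trans (cong (splitAt m) eq) (splitAt-↑ʳ m k j))
    ... | ()

  traces : Rel (m + k) → Fin m → Subset k
  traces Q i j = not (Q (i ↑ˡ k) (m ↑ʳ j))

  order : (Fin m → Subset k) → Fin m ⊎ Fin k → Fin m ⊎ Fin k → Bool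
  order T (inj₁ i) (inj₁ i′) = does (i ≟ᶠ i′)
  order T (inj₁ i) (inj₂ j)  = not (T i j)
  order T (inj₂ j) (inj₁ i)  = false
  order T (inj₂ j) (inj₂ j′) = R j j′

  extension : (Fin m → Subset k) → Rel (m + k)
  extension T u v = order T (splitAt m u) (splitAt m v)

  extension-join : ∀ T s t → extension T (join m k s) (join m k t) ≡ order T s t
  extension-join T s t = cong₂ (order T) (splitAt-join m k s) (splitAt-join m k t)

  DownsetRows : Pred (Fin m → Subset k) 0ℓ
  DownsetRows = VecAll.All (IsDownsetOf R full)

  downsetRows? : Decidable DownsetRows
  downsetRows? = VecAll.all (isDownsetOf? R full)

  Covers : Pred (Fin m → Subset k) 0ℓ
  Covers T = ∀ j → IsMinimal R j → ∃ λ i → T i j ≡ false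

  covers? : Decidable Covers
  covers? T = all? λ j → isMinimal? R j →-dec any? λ i → T i j ≟ᵇ false

  IsExtension-resp : IsExtension m P Respects _≋ᴿ_
  IsExtension-resp {Q} {Q′} Q≋Q′ ((Q-refl , Q-antisym , Q-trans) , Q-induces , M-minimal , K-not-minimal) =
    ((λ x → ≡′ x x (Q-refl x)) ,
     (λ x y Q′xy Q′yx → Q-antisym x y (≡′⁻ x y Q′xy) (≡′⁻ y x Q′yx)) ,
     (λ x y z Q′xy Q′yz → ≡′ x z (Q-trans x y z (≡′⁻ x y Q′xy) (≡′⁻ y z Q′yz)))) ,
    (λ i j → trans (sym (Q≋Q′ _ _)) (Q-induces i j)) ,
    (λ i y Q′yi → M-minimal i y (≡′⁻ y _ Q′yi)) ,
    (λ j Q′-minimal → K-not-minimal j λ y Qyj → Q′-minimal y (≡′ y _ Qyj))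
    where
    ≡′ : ∀ x y → Q x y ≡ true → Q′ x y ≡ true
    ≡′ x y = trans (sym (Q≋Q′ x y))
    ≡′⁻ : ∀ x y → Q′ x y ≡ true → Q x y ≡ true
    ≡′⁻ x y = trans (Q≋Q′ x y)

  module _ {Q : Rel (m + k)} (Q-ext : IsExtension m P Q) where
    private
      Q-refl    = proj₁ (proj₁ Q-ext)
      Q-trans   = proj₂ (proj₂ (proj₁ Q-ext))
      Q-induces = proj₁ (proj₂ Q-ext)
      M-minimal = proj₁ (proj₂ (proj₂ Q-ext))

    traces-isDownset : ∀ i → IsDownsetOf R full (traces Q i)
    traces-isDownset i = (λ _ _ → refl) , λ x y _ _ y≼x Tix →
      not≡true⁺ λ i≤y → not≡true⁻ Tix (Q-trans _ _ _ i≤y (trans (Q-induces y x) y≼x))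

    extension-traces : ∀ u v → Q u v ≡ extension (traces Q) u v
    extension-traces u v = subst₂ (λ u v → Q u v ≡ extension (traces Q) u v)
      (join-splitAt m k u) (join-splitAt m k v)
      (trans (on-order (splitAt m u) (splitAt m v)) (sym (extension-join (traces Q) (splitAt m u) (splitAt m v))))
      where
      on-order : ∀ s t → Q (join m k s) (join m k t) ≡ order (traces Q) s t
      on-order (inj₁ i) (inj₁ i′) with i ≟ᶠ i′
      ... | yes refl = Q-refl _
      ... | no i≢i′  = ¬-not λ Qii′ → i≢i′ (↑ˡ-injective k i i′ (M-minimal i′ _ Qii′))
      on-order (inj₁ i) (inj₂ j)  = sym (not-involutive _)
      on-order (inj₂ j) (inj₁ i)  = ¬-not λ Qji → ↑ˡ≢↑ʳ i j (sym (M-minimal i _ Qji))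
      on-order (inj₂ j) (inj₂ j′) = Q-induces j j′

  traces-extension : ∀ T → traces (extension T) ≋ T
  traces-extension T i j = trans (cong not (extension-join T (inj₁ i) (inj₂ j))) (not-involutive (T i j))

  extension-cong : ∀ {T T′} → T ≋ T′ → extension T ≋ᴿ extension T′
  extension-cong {T} {T′} T≋T′ u v = on-order (splitAt m u) (splitAt m v)
    where
    on-order : ∀ s t → order T s t ≡ order T′ s t
    on-order (inj₁ i) (inj₁ i′) = refl
    on-order (inj₁ i) (inj₂ j)  = cong not (T≋T′ i j)
    on-order (inj₂ j) (inj₁ i)  = refl
    on-order (inj₂ j) (inj₂ j′) = refl

  module _ {T} (T-rows : DownsetRows T) where
    private
      order-refl : ∀ s → order T s s ≡ true
      order-refl (inj₁ i) = dec-true (i ≟ᶠ i) refl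
      order-refl (inj₂ j) = ≼-refl j

      order-antisym : ∀ s t → order T s t ≡ true → order T t s ≡ true → s ≡ t
      order-antisym (inj₁ i) (inj₁ i′) s≤t _ = cong inj₁ (witness (i ≟ᶠ i′) s≤t)
      order-antisym (inj₁ i) (inj₂ j)  _   ()
      order-antisym (inj₂ j) (inj₁ i)  ()
      order-antisym (inj₂ j) (inj₂ j′) s≤t t≤s = cong inj₂ (≼-antisym j j′ s≤t t≤s)

      order-trans : ∀ s t u → order T s t ≡ true → order T t u ≡ true → order T s u ≡ true
      order-trans (inj₁ i) (inj₁ i′) u s≤t t≤u with witness (i ≟ᶠ i′) s≤t
      ... | refl = t≤u
      order-trans (inj₁ i) (inj₂ j) (inj₁ _)  _ ()
      order-trans (inj₁ i) (inj₂ j) (inj₂ j′) s≤t t≤u =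
        not≡true⁺ λ Tij′ → not≡true⁻ s≤t (proj₂ (T-rows i) j′ j refl refl t≤u Tij′)
      order-trans (inj₂ j) (inj₁ _)  _         ()
      order-trans (inj₂ j) (inj₂ j′) (inj₁ _)  _ ()
      order-trans (inj₂ j) (inj₂ j′) (inj₂ j″) = ≼-trans j j′ j″

      below-inj₁ : ∀ {i} s → order T s (inj₁ i) ≡ true → s ≡ inj₁ i
      below-inj₁ {i} (inj₁ i′) s≤i = cong inj₁ (witness (i′ ≟ᶠ i) s≤i)
      below-inj₁     (inj₂ _)  ()

    extension-isPartialOrder : IsPartialOrder (extension T)
    extension-isPartialOrder =
      (λ u → order-refl (splitAt m u)) ,
      (λ u v u≤v v≤u → splitAt-injective (order-antisym (splitAt m u) (splitAt m v) u≤v v≤u)) ,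
      (λ u v w → order-trans (splitAt m u) (splitAt m v) (splitAt m w))
      where
      splitAt-injective : ∀ {u v} → splitAt m u ≡ splitAt m v → u ≡ v
      splitAt-injective {u} {v} eq =
        trans (sym (join-splitAt m k u)) (trans (cong (join m k) eq) (join-splitAt m k v))

    extension-isExtension : Covers T → IsExtension m P (extension T)
    extension-isExtension covers =
      extension-isPartialOrder ,
      (λ j j′ → extension-join T (inj₂ j) (inj₂ j′)) ,
      M-minimal ,
      K-not-minimal
      where
      M-minimal : ∀ i → IsMinimal (extension T) (i ↑ˡ k)
      M-minimal i y y≤i = trans (sym (join-splitAt m k y)) (cong (join m k)
        (below-inj₁ (splitAt m y) (subst (λ t → order T (splitAt m y) t ≡ true) (splitAt-↑ˡ m i k) y≤i)))
      -- A minimal element of K would be minimal in P, hence above some i ∈ M by the covering condition.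
      K-not-minimal : ∀ j → ¬ IsMinimal (extension T) (m ↑ʳ j)
      K-not-minimal j j-minimal =
        let j-minimal-in-P : IsMinimal R j
            j-minimal-in-P y y≼j =
              ↑ʳ-injective m y j (j-minimal (m ↑ʳ y) (trans (extension-join T (inj₂ y) (inj₂ j)) y≼j))
            i , Tij≡false = covers j j-minimal-in-P
        in ↑ˡ≢↑ʳ i j (j-minimal (i ↑ˡ k) (trans (extension-join T (inj₁ i) (inj₂ j)) (cong not Tij≡false)))

  private
    tuples = allFuns m (allSubsets k)
    tuples-isEnumeration = allFuns-isEnumeration (allSubsets-isEnumeration k) m
    rels-isEnumeration = allRels-isEnumeration (m + k)
    open IsEnumeration

  count-downsetRows : count downsetRows? tuples ≡ d P ^ m
  count-downsetRows = count-allFuns (isDownsetOf? R full) m (allSubsets k)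

  e≤count-downsetRows : e m P ≤ count downsetRows? tuples
  e≤count-downsetRows = count-≤-injection (isExtension? m P) downsetRows?
    (λ T≋T′ rows i → IsDownsetOf-respʳ R (T≋T′ i) (rows i)) tracing
    (unique rels-isEnumeration) (complete tuples-isEnumeration)
    where
    tracing : InjectionOn (Relₛ (m + k)) Tupleₛ (IsExtension m P) DownsetRows
    tracing = record
      { to        = traces
      ; maps      = traces-isDownset
      ; injective = λ Q-ext Q′-ext traces≋ u v → trans (extension-traces Q-ext u v)
                      (trans (extension-cong traces≋ u v) (sym (extension-traces Q′-ext u v)))
      }

  count-covering≤e : count (downsetRows? ∩? covers?) tuples ≤ e m P
  count-covering≤e = count-≤-injection (downsetRows? ∩? covers?) (isExtension? m P) IsExtension-resp gluing
    (unique tuples-isEnumeration) (complete rels-isEnumeration)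
    where
    gluing : InjectionOn Tupleₛ (Relₛ (m + k)) (DownsetRows ∩ Covers) (IsExtension m P)
    gluing = record
      { to        = extension
      ; maps      = λ (rows , covers) → extension-isExtension rows covers
      ; injective = λ {T} {T′} _ _ extension≋ i j → trans (sym (traces-extension T i j))
                      (trans (cong not (extension≋ _ _)) (traces-extension T′ i j))
      }

  count-uncovering≤ : count (downsetRows? ∩? ∁? covers?) tuples ≤ minCount P * d′ P ^ m
  count-uncovering≤ = count-union-bound (downsetRows? ∩? ∁? covers?) rowsContaining?
    (filter (isMinimal? R) (allFin k)) uncovered tuples bound
    where
    rowsContaining? : ∀ p → Decidable (VecAll.All (IsDownsetOf R full ∩ Contains p))
    rowsContaining? p = VecAll.all (isDownsetOf? R full ∩? λ D → D p ≟ᵇ true)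
    bound : ∀ p → count (rowsContaining? p) tuples ≤ d′ P ^ m
    bound p = ≤-trans (≤-reflexive (count-allFuns _ m (allSubsets k)))
                      (^-monoˡ-≤ m (count-downsets-∋≤d′ P p))
    uncovered : ∀ {T} → (DownsetRows ∩ ∁ Covers) T →
      Any (λ p → VecAll.All (IsDownsetOf R full ∩ Contains p) T) (filter (isMinimal? R) (allFin k))
    uncovered {T} (rows , ¬covers) = Any.map (λ { refl → λ i → rows i , all-rows-∋j i })
      (∈≡.∈-filter⁺ (isMinimal? R) (∈≡.∈-allFin j) j-minimal)
      where
      j,¬covered = ¬∀⟶∃¬ k _ (λ j → isMinimal? R j →-dec any? λ i → T i j ≟ᵇ false) ¬covers
      j = proj₁ j,¬covered
      j-minimal : IsMinimal R j
      j-minimal with isMinimal? R j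
      ... | yes minimal  = minimal
      ... | no ¬minimal = contradiction (λ minimal → contradiction minimal ¬minimal) (proj₂ j,¬covered)
      all-rows-∋j : ∀ i → T i j ≡ true
      all-rows-∋j i = ¬-not λ Tij≡false → proj₂ j,¬covered λ _ → i , Tij≡false

  d^m≤e+minCount*d′^m : d P ^ m ≤ e m P + minCount P * d′ P ^ m
  d^m≤e+minCount*d′^m = begin
    d P ^ m                                            ≡⟨ count-downsetRows ⟨
    count downsetRows? tuples                          ≤⟨ count-mono downsetRows? (covering? ∪? uncovering?) split tuples ⟩
    count (covering? ∪? uncovering?) tuples            ≤⟨ count-∪ covering? uncovering? tuples ⟩
    count covering? tuples + count uncovering? tuples  ≤⟨ +-mono-≤ count-covering≤e count-uncovering≤ ⟩
    e m P + minCount P * d′ P ^ m                      ∎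
    where
    open ≤-Reasoning
    covering? = downsetRows? ∩? covers?
    uncovering? = downsetRows? ∩? ∁? covers?
    split : DownsetRows ⊆ (DownsetRows ∩ Covers) ∪ (DownsetRows ∩ ∁ Covers)
    split {T} rows with covers? T
    ... | yes covers  = inj₁ (rows , covers)
    ... | no ¬covers = inj₂ (rows , ¬covers)

n<2^n : ∀ n → n < 2 ^ n
n<2^n zero    = s≤s z≤n
n<2^n (suc n) = begin-strict
  suc n          ≤⟨ n<2^n n ⟩
  2 ^ n          <⟨ m<m+n (2 ^ n) (m^n>0 2 n) ⟩
  2 ^ n + 2 ^ n  ≡⟨ cong (2 ^ n +_) (+-identityʳ (2 ^ n)) ⟨
  2 ^ suc n      ∎
  where open ≤-Reasoning

n≤2^[n∸1] : ∀ n → n ≤ 2 ^ (n ∸ 1)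
n≤2^[n∸1] zero    = z≤n
n≤2^[n∸1] (suc n) = n<2^n n

2^a*[2^a]^m≡2^[a*[m+1]] : ∀ a m → 2 ^ a * (2 ^ a) ^ m ≡ 2 ^ (a * (m + 1))
2^a*[2^a]^m≡2^[a*[m+1]] a m = begin
  2 ^ a * (2 ^ a) ^ m  ≡⟨ cong (2 ^ a *_) (^-*-assoc 2 a m) ⟩
  2 ^ a * 2 ^ (a * m)  ≡⟨ ^-distribˡ-+-* 2 a (a * m) ⟨
  2 ^ (a + a * m)      ≡⟨ cong (2 ^_) exponents ⟩
  2 ^ (a * (m + 1))    ∎
  where
  open ≡-Reasoning
  exponents : a + a * m ≡ a * (m + 1)
  exponents = begin
    a + a * m      ≡⟨ +-comm a (a * m) ⟩
    a * m + a      ≡⟨ cong (a * m +_) (*-identityʳ a) ⟨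
    a * m + a * 1  ≡⟨ *-distribˡ-+ a m 1 ⟨
    a * (m + 1)    ∎

minCount≤k : ∀ {k} (P : Poset k) → minCount P ≤ k
minCount≤k {k} P = ≤-trans (length-filter (isMinimal? (_≤P_ P)) (allFin k)) (≤-reflexive (length-tabulate id))

theorem6p2 : ∀ {k} (P : Poset k) → 0 < k →
    (d′ P ≤ 2 ^ (k ∸ 1)) ×
    (d′ P < d P) ×
    (∀ (m : ℕ) → 0 < m →
      (e m P ≤ d P ^ m) ×
      (d P ^ m ∸ e m P ≤ 2 ^ (minCount P ∸ 1) * d′ P ^ m) ×
      (2 ^ (minCount P ∸ 1) * d′ P ^ m ≤ 2 ^ ((k ∸ 1) * (m + 1))))
theorem6p2 {zero}  P ()
theorem6p2 {suc k} P _ = d′≤2^k , d′<d , λ m _ → e≤d^m m , r≤ m , bound m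
  where
  open Extensions P
  d′≤2^k : d′ P ≤ 2 ^ k
  d′≤2^k = d′-preserves P {_≤ 2 ^ k} ⊔-lub z≤n (count-downsets-≤-2^ (_≤P_ P) _)
  d′<d : d′ P < d P
  d′<d = d′-preserves P {_< d P} ⊔-lub (≤-trans (s≤s z≤n) (dRestr<d P {λ _ → false} (zero , refl)))
                                       (dRestr<d P)
  e≤d^m : ∀ m → e m P ≤ d P ^ m
  e≤d^m m = ≤-trans (e≤count-downsetRows m) (≤-reflexive (count-downsetRows m))
  r≤ : ∀ m → d P ^ m ∸ e m P ≤ 2 ^ (minCount P ∸ 1) * d′ P ^ m
  r≤ m = ≤-trans (m≤n+o⇒m∸n≤o (d P ^ m) (e m P) (d^m≤e+minCount*d′^m m))
                 (*-monoˡ-≤ (d′ P ^ m) (n≤2^[n∸1] (minCount P)))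
  bound : ∀ m → 2 ^ (minCount P ∸ 1) * d′ P ^ m ≤ 2 ^ (k * (m + 1))
  bound m = ≤-trans (*-mono-≤ (^-monoʳ-≤ 2 (∸-monoˡ-≤ 1 (minCount≤k P))) (^-monoˡ-≤ m d′≤2^k))
                    (≤-reflexive (2^a*[2^a]^m≡2^[a*[m+1]] k m))
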